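{- Let $n\ge 2$ with prime factorization $n=2^{\alpha_0}p_1^{\alpha_1}\cdots p_k^{\alpha_k}$, where $p_1<\dots<p_k$ are distinct odd primes, $\alpha_i\ge1$ for $1\le i\le k$, and $\alpha_0\ge 0$. For a nonnegative integer $j$, $c(j,n)$ is an odd integer if and only if $4\nmid n$ and $j=p_1^{\alpha_1-1}\cdots p_k^{\alpha_k-1}J$ for some integer $J$ with $\gcd(J,n)\in\{1,2\}$.
   Context: The Ramanujan function is $c(j,m)=\mu(t_{m,j})\,\varphi(m)/\varphi(t_{m,j})$ with $t_{m,j}=m/\gcd(m,j)$ ($\gcd(m,0)=m$), where $\mu$ is the Möbius function and $\varphi$ Euler's totient function. -}

module Defs where

open import Data.Nat using (ℕ; zero; suc; _*_; _/_; _≟_; _^_)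
open import Data.Nat.GCD using (gcd)
open import Data.Nat.Divisibility using (_∣?_)
open import Data.Nat.Primality using (prime?)
open import Data.Integer as ℤ using (ℤ; +_; -[1+_]; 0ℤ; 1ℤ)
open import Data.List using (List; length; filter; applyUpTo)
open import Data.List.Relation.Unary.All using (all?)
open import Data.Fin using (Fin)
open import Relation.Nullary.Decidable using (Dec; yes; no; ¬?; _×-dec_)

range1 : ℕ → List ℕ
range1 n = applyUpTo suc n

-- total division: m ÷ 0 = 0 (only ever used with a nonzero divisor here)
_div_ : ℕ → ℕ → ℕ
m div zero    = 0
m div (suc k) = m / suc k

φ : ℕ → ℕ
φ n = length (filter (λ k → gcd k n ≟ 1) (range1 n))

ω : ℕ → ℕ
ω n = length (filter (λ p → prime? p ×-dec (p ∣? n)) (range1 n))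

μ : ℕ → ℤ
μ n with all? (λ p → ¬? (prime? p ×-dec ((p * p) ∣? n))) (range1 n)
... | yes _ = (ℤ.- 1ℤ) ℤ.^ ω n
... | no  _ = 0ℤ

t : ℕ → ℕ → ℕ
t m j = m div gcd m j

-- Ramanujan function c(j,m) = μ(t_{m,j}) φ(m)/φ(t_{m,j})
c : ℕ → ℕ → ℤ
c j m = μ (t m j) ℤ.* (+ (φ m div φ (t m j)))

prodFin : (k : ℕ) → (Fin k → ℕ) → ℕ
prodFin zero    f = 1
prodFin (suc k) f = f Fin.zero * prodFin k (λ i → f (Fin.suc i))

-- Write d = gcd(n, j) and t = n / d, so that c(j, n) = μ(t) · φ(t d) / φ(t).  Adjoining the prime
-- factors q of d one at a time, φ(t d′ q) = φ(t d′) · q or φ(t d′) · (q − 1) according as q divides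
-- t d′ or not, so φ(t d) / φ(t) is odd exactly when every odd prime of d divides t, 4 ∤ d, and t is
-- odd whenever d is even.  Together with "t squarefree" (μ(t) ≠ 0) this says, prime by prime, that
-- 4 ∤ n and that p_i^(α_i − 1) exactly divides j; that is, j = p_1^(α_1 − 1) ⋯ p_k^(α_k − 1) · J
-- with no p_i dividing J, i.e. gcd(J, n) ∈ {1, 2}.

module Submission where

open import Defs
open import Data.Nat using (ℕ; _≤_; _<_; _^_; _*_; _∸_)
open import Data.Nat.Divisibility using (_∣_)
open import Data.Nat.Primality using (Prime)
open import Data.Fin as Fin using (Fin)
import Data.Fin.Properties as FinP
open import Data.Integer as ℤ using (ℤ; +_)
open import Data.Integer.Divisibility as ℤD using ()
open import Data.Integer.GCD as ℤG using ()
open import Data.Product using (Σ; ∃; _×_)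
open import Data.Sum using (_⊎_)
open import Relation.Nullary using (¬_)
open import Relation.Binary.PropositionalEquality using (_≡_)
open import Function.Bundles using (_⇔_)

open import Data.Bool.Base using (Bool; true; false; _∧_; not)
open import Data.Bool.Properties using (∧-identityʳ; ∧-zeroʳ)
open import Data.Empty using (⊥; ⊥-elim)
open import Data.List.Base using ([]; _∷_; length; filter; applyUpTo)
open import Data.List.Relation.Unary.All using (All; []; _∷_; all?)
open import Data.List.Relation.Unary.All.Properties using (applyUpTo⁺₂; applyUpTo⁻)
open import Data.Nat.Base using (zero; suc; _+_; NonZero; z≤n; s≤s; nonTrivial⇒≢1; >-nonZero; >-nonZero⁻¹; ≢-nonZero; ≢-nonZero⁻¹)
open import Data.Nat.Divisibility
open import Data.Nat.DivMod using (m*n/n≡m; m/n*n≡m)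
open import Data.Nat.Coprimality using (coprime-divisor; gcd≡1⇒coprime)
open import Data.Nat.GCD using (gcd; gcd[m,n]∣m; gcd[m,n]∣n; gcd-greatest; gcd[m,n]≢0; gcd-zeroˡ)
open import Data.Nat.Primality using (prime?; prime[2]; prime⇒nonZero; prime⇒nonTrivial; prime⇒irreducible; euclidsLemma)
open import Data.Nat.Primality.Factorisation using (factorise)
open import Data.Nat.Properties
import Data.Integer.Properties as ℤP
open import Algebra.Properties.CommutativeSemigroup *-commutativeSemigroup using (x∙yz≈y∙xz)
open import Data.Product using (_,_; proj₁; proj₂; uncurry)
open import Data.Sum using (inj₁; inj₂)
import Data.Sum as Sum
open import Function.Bundles using (mk⇔; Equivalence)
open import Function.Base using (case_of_; it; _∘_)
open import Function.Definitions using (Injective)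
open import Relation.Binary.Definitions using (tri<; tri≈; tri>)
open import Function.Properties.Equivalence using () renaming (refl to ⇔-refl; trans to ⇔-trans; sym to ⇔-sym)
open import Data.Product.Function.NonDependent.Propositional using (_×-⇔_)
open import Relation.Binary.PropositionalEquality using (_≢_; refl; sym; trans; cong; cong₂; subst; module ≡-Reasoning)
open import Relation.Nullary.Decidable using (yes; no; does; _×-dec_; ¬?; dec-true; dec-false; does-⇔)
open import Relation.Unary using (Decidable)
open import Data.Nat.Solver using (module +-*-Solver)
open import Data.Nat.ListAction using (product)

Odd : ℕ → Set
Odd n = ¬ 2 ∣ n

prime≢1 : ∀ {p} → Prime p → p ≢ 1
prime≢1 p-prime = nonTrivial⇒≢1 {{prime⇒nonTrivial p-prime}}

prime∣prime⇒≡ : ∀ {q p} → Prime q → Prime p → q ∣ p → q ≡ p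
prime∣prime⇒≡ q-prime p-prime q∣p with prime⇒irreducible p-prime q∣p
... | inj₁ q≡1 = ⊥-elim (prime≢1 q-prime q≡1)
... | inj₂ q≡p = q≡p

prime∣^⇒≡ : ∀ {q p} → Prime q → Prime p → ∀ e → q ∣ p ^ e → q ≡ p
prime∣^⇒≡ q-prime p-prime zero q∣1 = ⊥-elim (prime≢1 q-prime (∣1⇒≡1 q∣1))
prime∣^⇒≡ {p = p} q-prime p-prime (suc e) q∣p^[1+e] with euclidsLemma p (p ^ e) q-prime q∣p^[1+e]
... | inj₁ q∣p = prime∣prime⇒≡ q-prime p-prime q∣p
... | inj₂ q∣p^e = prime∣^⇒≡ q-prime p-prime e q∣p^e

prime∣2⇒≡2 : ∀ {q} → Prime q → q ∣ 2 → q ≡ 2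
prime∣2⇒≡2 q-prime = prime∣prime⇒≡ q-prime prime[2]

odd⇒≢2 : ∀ {q} → Odd q → q ≢ 2
odd⇒≢2 q-odd refl = q-odd ∣-refl

p^[1+e]∣p^e*m⇔p∣m : ∀ p .{{_ : NonZero p}} e m → p ^ suc e ∣ p ^ e * m ⇔ p ∣ m
p^[1+e]∣p^e*m⇔p∣m p e m = mk⇔
  (λ p^[1+e]∣p^e*m → *-cancelˡ-∣ (p ^ e) {{m^n≢0 p e}} (subst (_∣ p ^ e * m) (*-comm p (p ^ e)) p^[1+e]∣p^e*m))
  (λ p∣m → subst (_∣ p ^ e * m) (*-comm (p ^ e) p) (*-monoʳ-∣ (p ^ e) p∣m))

odd-*⇔ : ∀ {a b} → Odd (a * b) ⇔ (Odd a × Odd b)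
odd-*⇔ {a} {b} = mk⇔
  (λ ab-odd → (λ 2∣a → ab-odd (∣m⇒∣m*n b 2∣a)) , (λ 2∣b → ab-odd (∣n⇒∣m*n a 2∣b)))
  (λ (a-odd , b-odd) 2∣ab → case euclidsLemma a b prime[2] 2∣ab of λ where
     (inj₁ 2∣a) → a-odd 2∣a
     (inj₂ 2∣b) → b-odd 2∣b)

odd[1] : Odd 1
odd[1] 2∣1 with ∣1⇒≡1 2∣1
... | ()

odd[2] : ¬ Odd 2
odd[2] 2-odd = 2-odd ∣-refl

even⊎even[1+] : ∀ n → 2 ∣ n ⊎ 2 ∣ suc n
even⊎even[1+] zero    = inj₁ (2 ∣0)
even⊎even[1+] (suc n) with even⊎even[1+] n
... | inj₁ 2∣n   = inj₂ (∣m∣n⇒∣m+n (∣-refl {2}) 2∣n)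
... | inj₂ 2∣1+n = inj₁ 2∣1+n

odd⇒even[∸1] : ∀ {q} → .{{NonZero q}} → Odd q → 2 ∣ q ∸ 1
odd⇒even[∸1] {suc q} q-odd with even⊎even[1+] q
... | inj₁ 2∣q   = 2∣q
... | inj₂ 2∣1+q = ⊥-elim (q-odd 2∣1+q)

prime-divisor : ∀ {n} → 2 ≤ n → ∃ λ q → Prime q × q ∣ n
prime-divisor {1} (s≤s ())
prime-divisor {n@(suc (suc _))} _ with factorise n
... | record { factors = [] ; isFactorisation = () }
... | record { factors = q ∷ qs ; isFactorisation = n≡q*qs ; factorsPrime = q-prime ∷ _ } =
  q , q-prime , subst (q ∣_) (sym n≡q*qs) (m∣m*n _)

noPrimeDivisor⇒≡1 : ∀ g → (∀ q → Prime q → ¬ q ∣ g) → g ≡ 1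
noPrimeDivisor⇒≡1 zero         primeFree = ⊥-elim (primeFree 2 prime[2] (2 ∣0))
noPrimeDivisor⇒≡1 (suc zero)    _        = refl
noPrimeDivisor⇒≡1 (suc (suc g)) primeFree with prime-divisor {suc (suc g)} (s≤s (s≤s z≤n))
... | q , q-prime , q∣g = ⊥-elim (primeFree q q-prime q∣g)

odd∧noOddPrime⇒≡1 : ∀ {h} → Odd h → (∀ q → Prime q → Odd q → ¬ q ∣ h) → h ≡ 1
odd∧noOddPrime⇒≡1 {h} h-odd noOddPrime = noPrimeDivisor⇒≡1 h (λ q q-prime q∣h → case 2 ∣? q of λ where
  (yes 2∣q) → h-odd (∣-trans 2∣q q∣h)
  (no  q-odd) → noOddPrime q q-prime q-odd q∣h)

noOddPrime⇒≡1⊎≡2 : ∀ {g} → ¬ 4 ∣ g → (∀ q → Prime q → Odd q → ¬ q ∣ g) → g ≡ 1 ⊎ g ≡ 2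
noOddPrime⇒≡1⊎≡2 {g} 4∤g noOddPrime with 2 ∣? g
... | no  g-odd = inj₁ (odd∧noOddPrime⇒≡1 g-odd noOddPrime)
... | yes (divides h g≡h*2) = inj₂ (trans g≡h*2 (cong (_* 2) (odd∧noOddPrime⇒≡1 h-odd
        (λ q q-prime q-odd q∣h → noOddPrime q q-prime q-odd (subst (q ∣_) (sym g≡h*2) (∣m⇒∣m*n 2 q∣h))))))
  where
  h-odd : Odd h
  h-odd 2∣h = 4∤g (subst (4 ∣_) (sym g≡h*2) (*-monoˡ-∣ 2 2∣h))

NoCommonPrime : ℕ → ℕ → Set
NoCommonPrime x y = ∀ q → Prime q → q ∣ x → q ∣ y → ⊥

gcd≡1⇔noCommonPrime : ∀ {x y} → gcd x y ≡ 1 ⇔ NoCommonPrime x y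
gcd≡1⇔noCommonPrime {x} {y} = mk⇔
  (λ gcd≡1 q q-prime q∣x q∣y → prime≢1 q-prime (∣1⇒≡1 (subst (q ∣_) gcd≡1 (gcd-greatest q∣x q∣y))))
  (λ coprime → noPrimeDivisor⇒≡1 (gcd x y)
    (λ q q-prime q∣gcd → coprime q q-prime (∣-trans q∣gcd (gcd[m,n]∣m x y)) (∣-trans q∣gcd (gcd[m,n]∣n x y))))

prime^∣*⇒∣ : ∀ {p m} → Prime p → ¬ p ∣ m → ∀ e {n} → p ^ e ∣ m * n → p ^ e ∣ n
prime^∣*⇒∣ {p} {m} p-prime p∤m e = coprime-divisor (gcd≡1⇒coprime (Equivalence.from gcd≡1⇔noCommonPrime
  λ q q-prime q∣p^e q∣m → p∤m (subst (_∣ m) (prime∣^⇒≡ q-prime p-prime e q∣p^e) q∣m)))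

noCommonPrime-sym : ∀ {x y} → NoCommonPrime x y → NoCommonPrime y x
noCommonPrime-sym coprime q q-prime q∣y q∣x = coprime q q-prime q∣x q∣y

noCommonPrime-*-prime : ∀ {p x m} → Prime p → NoCommonPrime x (m * p) ⇔ (NoCommonPrime x m × ¬ p ∣ x)
noCommonPrime-*-prime {p} {x} {m} p-prime = mk⇔
  (λ coprime → (λ q q-prime q∣x q∣m → coprime q q-prime q∣x (∣m⇒∣m*n p q∣m)) ,
               (λ p∣x → coprime p p-prime p∣x (n∣m*n m)))
  (λ (coprime , p∤x) q q-prime q∣x q∣mp → case euclidsLemma m p q-prime q∣mp of λ where
     (inj₁ q∣m) → coprime q q-prime q∣x q∣m
     (inj₂ q∣p) → p∤x (subst (_∣ x) (prime∣prime⇒≡ q-prime p-prime q∣p) q∣x))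

-- Counting

fromBool : Bool → ℕ
fromBool true  = 1
fromBool false = 0

count : (ℕ → Bool) → ℕ → ℕ
count b zero    = 0
count b (suc n) = count b n + fromBool (b n)

count-suc : ∀ b n → count b (suc n) ≡ fromBool (b 0) + count (λ i → b (suc i)) n
count-suc b zero    = +-comm 0 (fromBool (b 0))
count-suc b (suc n) = trans (cong (_+ fromBool (b (suc n))) (count-suc b n))
  (+-assoc (fromBool (b 0)) (count (λ i → b (suc i)) n) (fromBool (b (suc n))))

count-+ : ∀ b m n → count b (m + n) ≡ count b m + count (λ i → b (m + i)) n
count-+ b m zero    = trans (cong (count b) (+-identityʳ m)) (sym (+-identityʳ (count b m)))
count-+ b m (suc n) = begin
  count b (m + suc n)                                                ≡⟨ cong (count b) (+-suc m n) ⟩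
  count b (m + n) + fromBool (b (m + n))                             ≡⟨ cong (_+ fromBool (b (m + n))) (count-+ b m n) ⟩
  count b m + count (λ i → b (m + i)) n + fromBool (b (m + n))       ≡⟨ +-assoc (count b m) _ _ ⟩
  count b m + (count (λ i → b (m + i)) n + fromBool (b (m + n)))     ∎
  where open ≡-Reasoning

count-cong : ∀ {b b′} → (∀ i → b i ≡ b′ i) → ∀ n → count b n ≡ count b′ n
count-cong b≗b′ zero    = refl
count-cong b≗b′ (suc n) = cong₂ _+_ (count-cong b≗b′ n) (cong fromBool (b≗b′ n))

count-periodic : ∀ b m → (∀ i → b (m + i) ≡ b i) → ∀ q → count b (q * m) ≡ q * count b m
count-periodic b m periodic zero    = refl
count-periodic b m periodic (suc q) = trans (count-+ b m (q * m))
  (cong (λ z → count b m + z) (trans (count-cong periodic (q * m)) (count-periodic b m periodic q)))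

count-∧-split : ∀ (b c : ℕ → Bool) n → count (λ i → b i ∧ c i) n + count (λ i → b i ∧ not (c i)) n ≡ count b n
count-∧-split b c zero    = refl
count-∧-split b c (suc n) = begin
  (C∧ + fromBool (b n ∧ c n)) + (C∧¬ + fromBool (b n ∧ not (c n)))
    ≡⟨ +-*-Solver.solve 4 (λ w x y z → (w :+ x) :+ (y :+ z) := (w :+ y) :+ (x :+ z)) refl
         C∧ (fromBool (b n ∧ c n)) C∧¬ (fromBool (b n ∧ not (c n))) ⟩
  (C∧ + C∧¬) + (fromBool (b n ∧ c n) + fromBool (b n ∧ not (c n)))
    ≡⟨ cong₂ _+_ (count-∧-split b c n) (split (b n) (c n)) ⟩
  count b n + fromBool (b n) ∎
  where
  open ≡-Reasoning
  open +-*-Solver using (_:+_; _:=_)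
  C∧ C∧¬ : ℕ
  C∧  = count (λ i → b i ∧ c i) n
  C∧¬ = count (λ i → b i ∧ not (c i)) n
  split : ∀ u v → fromBool (u ∧ v) + fromBool (u ∧ not v) ≡ fromBool u
  split true  true  = refl
  split true  false = refl
  split false _     = refl

count-none : ∀ b n → (∀ i → i < n → b i ≡ false) → count b n ≡ 0
count-none b zero    _    = refl
count-none b (suc n) none = cong₂ _+_ (count-none b n (λ i i<n → none i (m<n⇒m<1+n i<n))) (cong fromBool (none n ≤-refl))

length-filter-applyUpTo : ∀ {P : ℕ → Set} (P? : Decidable P) f n →
  length (filter P? (applyUpTo f n)) ≡ count (λ i → does (P? (f i))) n
length-filter-applyUpTo P? f zero    = refl
length-filter-applyUpTo P? f (suc n) = trans head (sym (count-suc (λ i → does (P? (f i))) n))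
  where
  head : length (filter P? (f 0 ∷ applyUpTo (λ i → f (suc i)) n)) ≡
         fromBool (does (P? (f 0))) + count (λ i → does (P? (f (suc i)))) n
  head with does (P? (f 0))
  ... | true  = cong suc (length-filter-applyUpTo P? (λ i → f (suc i)) n)
  ... | false = length-filter-applyUpTo P? (λ i → f (suc i)) n

count-multiples : ∀ (a : ℕ → Bool) p .{{_ : NonZero p}} m →
  count (λ i → a (suc i) ∧ does (p ∣? suc i)) (m * p) ≡ count (λ y → a (suc y * p)) m
count-multiples a p zero    = refl
count-multiples a p (suc m) = begin
  count b (p + m * p)                                         ≡⟨ count-+ b p (m * p) ⟩
  count b p + count (λ i → b (p + i)) (m * p)                 ≡⟨ cong₂ _+_ (first-block p)
                                                                   (trans (count-cong shift (m * p)) (count-multiples (λ x → a (p + x)) p m)) ⟩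
  fromBool (a p) + count (λ y → a (suc (suc y) * p)) m        ≡⟨ cong (λ z → fromBool (a z) + count (λ y → a (suc (suc y) * p)) m)
                                                                   (sym (*-identityˡ p)) ⟩
  fromBool (a (1 * p)) + count (λ y → a (suc (suc y) * p)) m  ≡⟨ count-suc (λ y → a (suc y * p)) m ⟨
  count (λ y → a (suc y * p)) (suc m)                         ∎
  where
  open ≡-Reasoning
  b : ℕ → Bool
  b i = a (suc i) ∧ does (p ∣? suc i)
  first-block : ∀ p .{{_ : NonZero p}} → count (λ i → a (suc i) ∧ does (p ∣? suc i)) p ≡ fromBool (a p)
  first-block (suc p′) = cong₂ _+_
    (count-none _ p′ (λ i i<p′ → trans (cong (a (suc i) ∧_) (dec-false (suc p′ ∣? suc i) (λ p∣i → <⇒≱ (s≤s i<p′) (∣⇒≤ p∣i))))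
                                       (∧-zeroʳ _)))
    (cong fromBool (trans (cong (a (suc p′) ∧_) (dec-true (suc p′ ∣? suc p′) ∣-refl)) (∧-identityʳ _)))
  shift : ∀ i → b (p + i) ≡ a (p + suc i) ∧ does (p ∣? suc i)
  shift i = cong₂ _∧_ (cong a (sym (+-suc p i)))
    (trans (cong (λ z → does (p ∣? z)) (sym (+-suc p i)))
      (does-⇔ (mk⇔ (λ p∣p+i → ∣m+n∣m⇒∣n p∣p+i ∣-refl) (∣m∣n⇒∣m+n ∣-refl)) (p ∣? (p + suc i)) (p ∣? suc i)))

-- Euler's totient

coprimeTo : ℕ → ℕ → Bool
coprimeTo n x = does (gcd x n ≟ 1)

φ≡count : ∀ n → φ n ≡ count (λ i → coprimeTo n (suc i)) n
φ≡count n = length-filter-applyUpTo (λ k → gcd k n ≟ 1) suc n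

coprimeTo-≡ : ∀ {m n x y} → NoCommonPrime x m ⇔ NoCommonPrime y n → coprimeTo m x ≡ coprimeTo n y
coprimeTo-≡ {m} {n} {x} {y} x⊥m⇔y⊥n = does-⇔
  (⇔-trans gcd≡1⇔noCommonPrime (⇔-trans x⊥m⇔y⊥n (⇔-sym gcd≡1⇔noCommonPrime)))
  (gcd x m ≟ 1) (gcd y n ≟ 1)

coprimeTo-periodic : ∀ m i → coprimeTo m (suc (m + i)) ≡ coprimeTo m (suc i)
coprimeTo-periodic m i = coprimeTo-≡ {m} {m} {suc (m + i)} {suc i} (mk⇔
  (λ coprime q q-prime q∣1+i q∣m → coprime q q-prime (subst (q ∣_) (+-suc m i) (∣m∣n⇒∣m+n q∣m q∣1+i)) q∣m)
  (λ coprime q q-prime q∣1+m+i q∣m → coprime q q-prime (∣m+n∣m⇒∣n (subst (q ∣_) (sym (+-suc m i)) q∣1+m+i) q∣m) q∣m))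

coprimeTo-*-prime : ∀ {p m} → Prime p → ∀ x → coprimeTo (m * p) x ≡ coprimeTo m x ∧ not (does (p ∣? x))
coprimeTo-*-prime {p} {m} p-prime x = does-⇔
  (⇔-trans gcd≡1⇔noCommonPrime (⇔-trans (noCommonPrime-*-prime p-prime) (⇔-sym gcd≡1⇔noCommonPrime ×-⇔ ⇔-refl)))
  (gcd x (m * p) ≟ 1) ((gcd x m ≟ 1) ×-dec ¬? (p ∣? x))

coprimeTo-*-∣ : ∀ {p m} → Prime p → p ∣ m → ∀ x → coprimeTo (m * p) x ≡ coprimeTo m x
coprimeTo-*-∣ {p} {m} p-prime p∣m x = coprimeTo-≡ {m * p} {m} {x} {x} (⇔-trans (noCommonPrime-*-prime p-prime)
  (mk⇔ proj₁ (λ coprime → coprime , λ p∣x → coprime _ p-prime p∣x p∣m)))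

coprimeTo-*ˡ : ∀ {p m} → Prime p → ¬ p ∣ m → ∀ x → coprimeTo m (x * p) ≡ coprimeTo m x
coprimeTo-*ˡ {p} {m} p-prime p∤m x = coprimeTo-≡ {m} {m} {x * p} {x}
  (⇔-trans (mk⇔ noCommonPrime-sym noCommonPrime-sym) (⇔-trans (noCommonPrime-*-prime p-prime)
    (mk⇔ (λ (coprime , _) → noCommonPrime-sym coprime) (λ coprime → noCommonPrime-sym coprime , p∤m))))

φ-*-∣ : ∀ {p m} → Prime p → p ∣ m → φ (m * p) ≡ p * φ m
φ-*-∣ {p} {m} p-prime p∣m = begin
  φ (m * p)                                       ≡⟨ φ≡count (m * p) ⟩
  count (λ i → coprimeTo (m * p) (suc i)) (m * p) ≡⟨ count-cong (λ i → coprimeTo-*-∣ {m = m} p-prime p∣m (suc i)) (m * p) ⟩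
  count coprime (m * p)                           ≡⟨ cong (count coprime) (*-comm m p) ⟩
  count coprime (p * m)                           ≡⟨ count-periodic coprime m (coprimeTo-periodic m) p ⟩
  p * count coprime m                             ≡⟨ cong (p *_) (φ≡count m) ⟨
  p * φ m                                         ∎
  where
  open ≡-Reasoning
  coprime : ℕ → Bool
  coprime i = coprimeTo m (suc i)

-- Split the residues coprime to m in [1, p m] according to whether p divides them.
φ[m*p]+φ[m]≡p*φ[m] : ∀ {p m} → Prime p → ¬ p ∣ m → φ (m * p) + φ m ≡ p * φ m
φ[m*p]+φ[m]≡p*φ[m] {p} {m} p-prime p∤m = begin
  φ (m * p) + φ m                                     ≡⟨ cong₂ _+_ coprime-to-mp coprime-multiples ⟩
  count (λ i → A i ∧ not (D i)) (p * m) + count (λ i → A i ∧ D i) (p * m)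
    ≡⟨ +-comm (count (λ i → A i ∧ not (D i)) (p * m)) _ ⟩
  count (λ i → A i ∧ D i) (p * m) + count (λ i → A i ∧ not (D i)) (p * m)
    ≡⟨ count-∧-split A D (p * m) ⟩
  count A (p * m)                                     ≡⟨ count-periodic A m (coprimeTo-periodic m) p ⟩
  p * count A m                                       ≡⟨ cong (p *_) (φ≡count m) ⟨
  p * φ m                                             ∎
  where
  open ≡-Reasoning
  instance _ = prime⇒nonZero p-prime
  A D : ℕ → Bool
  A i = coprimeTo m (suc i)
  D i = does (p ∣? suc i)
  coprime-to-mp : φ (m * p) ≡ count (λ i → A i ∧ not (D i)) (p * m)
  coprime-to-mp = trans (φ≡count (m * p)) (trans (count-cong (λ i → coprimeTo-*-prime {m = m} p-prime (suc i)) (m * p))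
    (cong (count (λ i → A i ∧ not (D i))) (*-comm m p)))
  coprime-multiples : φ m ≡ count (λ i → A i ∧ D i) (p * m)
  coprime-multiples = sym (begin
    count (λ i → A i ∧ D i) (p * m)      ≡⟨ cong (count (λ i → A i ∧ D i)) (*-comm p m) ⟩
    count (λ i → A i ∧ D i) (m * p)      ≡⟨ count-multiples (coprimeTo m) p m ⟩
    count (λ y → coprimeTo m (suc y * p)) m ≡⟨ count-cong (λ y → coprimeTo-*ˡ {m = m} p-prime p∤m (suc y)) m ⟩
    count A m                            ≡⟨ φ≡count m ⟨
    φ m                                  ∎)

φ-*-∤ : ∀ {p m} → Prime p → ¬ p ∣ m → φ (m * p) ≡ (p ∸ 1) * φ m
φ-*-∤ {p} {m} p-prime p∤m = +-cancelʳ-≡ (φ m) _ _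
  (trans (φ[m*p]+φ[m]≡p*φ[m] p-prime p∤m) (p*x≡[p∸1]*x+x p {{prime⇒nonZero p-prime}}))
  where
  p*x≡[p∸1]*x+x : ∀ p .{{_ : NonZero p}} → p * φ m ≡ (p ∸ 1) * φ m + φ m
  p*x≡[p∸1]*x+x (suc p′) = +-comm (φ m) (p′ * φ m)

φ-factor : ℕ → ℕ → ℕ
φ-factor p m with p ∣? m
... | yes _ = p
... | no  _ = p ∸ 1

φ-*-prime : ∀ {p m} → Prime p → φ (m * p) ≡ φ-factor p m * φ m
φ-*-prime {p} {m} p-prime with p ∣? m
... | yes p∣m = φ-*-∣ p-prime p∣m
... | no  p∤m = φ-*-∤ p-prime p∤m

φ>0 : ∀ n .{{_ : NonZero n}} → 0 < φ n
φ>0 n@(suc n′) = subst (0 <_) (sym (trans (φ≡count n) (count-suc (λ i → coprimeTo n (suc i)) n′)))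
  (subst (λ b → 0 < fromBool b + count (λ i → coprimeTo n (suc (suc i))) n′)
    (sym (dec-true (gcd 1 n ≟ 1) (gcd-zeroˡ n))) (s≤s z≤n))

-- The condition under which φ (t * d) / φ t is odd; see φ-quotient.
record QuotientOdd (d t : ℕ) : Set where
  field
    odd-prime-∣ : ∀ q → Prime q → Odd q → q ∣ d → q ∣ t
    4∤ : ¬ 4 ∣ d
    2∣⇒odd : 2 ∣ d → Odd t

quotientOdd-1 : ∀ {t} → QuotientOdd 1 t
quotientOdd-1 = record
  { odd-prime-∣ = λ q q-prime _ q∣1 → ⊥-elim (prime≢1 q-prime (∣1⇒≡1 q∣1))
  ; 4∤          = λ 4∣1 → case ∣1⇒≡1 4∣1 of λ ()
  ; 2∣⇒odd      = λ 2∣1 → ⊥-elim (odd[1] 2∣1)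
  }

quotientOdd-*ˡ : ∀ {q d t} → QuotientOdd (q * d) t → QuotientOdd d t
quotientOdd-*ˡ {q} qd-odd = record
  { odd-prime-∣ = λ s s-prime s-odd s∣d → odd-prime-∣ s s-prime s-odd (∣n⇒∣m*n q s∣d)
  ; 4∤          = λ 4∣d → 4∤ (∣n⇒∣m*n q 4∣d)
  ; 2∣⇒odd      = λ 2∣d → 2∣⇒odd (∣n⇒∣m*n q 2∣d)
  }
  where open QuotientOdd qd-odd

quotientOdd-*-oddPrime : ∀ {q d t} → Prime q → Odd q →
  QuotientOdd (q * d) t ⇔ (Odd (φ-factor q (t * d)) × QuotientOdd d t)
quotientOdd-*-oddPrime {q} {d} {t} q-prime q-odd with q ∣? t * d
... | yes q∣td = mk⇔ (λ qd-odd → q-odd , quotientOdd-*ˡ {q} qd-odd) (λ (_ , d-odd) → extend d-odd)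
  where
  extend : QuotientOdd d t → QuotientOdd (q * d) t
  extend d-odd = record
    { odd-prime-∣ = λ s s-prime s-odd s∣qd → case euclidsLemma q d s-prime s∣qd of λ where
        (inj₁ s∣q) → subst (_∣ t) (sym (prime∣prime⇒≡ s-prime q-prime s∣q)) q∣t
        (inj₂ s∣d) → odd-prime-∣ s s-prime s-odd s∣d
    ; 4∤          = λ 4∣qd → 4∤ (prime^∣*⇒∣ prime[2] q-odd 2 4∣qd)
    ; 2∣⇒odd      = λ 2∣qd → case euclidsLemma q d prime[2] 2∣qd of λ where
        (inj₁ 2∣q) → ⊥-elim (q-odd 2∣q)
        (inj₂ 2∣d) → 2∣⇒odd 2∣d
    }
    where
    open QuotientOdd d-odd
    q∣t : q ∣ t
    q∣t = case euclidsLemma t d q-prime q∣td of λ where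
      (inj₁ q∣t) → q∣t
      (inj₂ q∣d) → odd-prime-∣ q q-prime q-odd q∣d
... | no q∤td = mk⇔
  (λ qd-odd → ⊥-elim (q∤td (∣m⇒∣m*n d (QuotientOdd.odd-prime-∣ qd-odd q q-prime q-odd (m∣m*n d)))))
  (λ (q∸1-odd , _) → ⊥-elim (q∸1-odd (odd⇒even[∸1] {{prime⇒nonZero q-prime}} q-odd)))

quotientOdd-*2 : ∀ {d t} → QuotientOdd (2 * d) t ⇔ (Odd (φ-factor 2 (t * d)) × QuotientOdd d t)
quotientOdd-*2 {d} {t} with 2 ∣? t * d
... | yes 2∣td = mk⇔
  (λ 2d-odd → ⊥-elim (case euclidsLemma t d prime[2] 2∣td of λ where
     (inj₁ 2∣t) → QuotientOdd.2∣⇒odd 2d-odd (m∣m*n d) 2∣t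
     (inj₂ 2∣d) → QuotientOdd.4∤ 2d-odd (*-monoʳ-∣ 2 2∣d)))
  (λ (2-odd , _) → ⊥-elim (odd[2] 2-odd))
... | no 2∤td = mk⇔ (λ 2d-odd → odd[1] , quotientOdd-*ˡ {2} 2d-odd) (λ (_ , d-odd) → extend d-odd)
  where
  extend : QuotientOdd d t → QuotientOdd (2 * d) t
  extend d-odd = record
    { odd-prime-∣ = λ s s-prime s-odd s∣2d → case euclidsLemma 2 d s-prime s∣2d of λ where
        (inj₁ s∣2) → ⊥-elim (odd⇒≢2 s-odd (prime∣2⇒≡2 s-prime s∣2))
        (inj₂ s∣d) → odd-prime-∣ s s-prime s-odd s∣d
    ; 4∤          = λ 4∣2d → 2∤td (∣n⇒∣m*n t (*-cancelˡ-∣ 2 4∣2d))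
    ; 2∣⇒odd      = λ _ 2∣t → 2∤td (∣m⇒∣m*n d 2∣t)
    }
    where open QuotientOdd d-odd

quotientOdd-*-prime : ∀ {q d t} → Prime q →
  QuotientOdd (q * d) t ⇔ (Odd (φ-factor q (t * d)) × QuotientOdd d t)
quotientOdd-*-prime {q} q-prime with 2 ∣? q
... | no  q-odd = quotientOdd-*-oddPrime q-prime q-odd
... | yes 2∣q with prime∣prime⇒≡ prime[2] q-prime 2∣q
...   | refl = quotientOdd-*2

φ-quotient-product : ∀ t {ps} → All Prime ps →
  ∃ λ r → φ (t * product ps) ≡ r * φ t × (Odd r ⇔ QuotientOdd (product ps) t)
φ-quotient-product t [] =
  1 , trans (cong φ (*-identityʳ t)) (sym (*-identityˡ (φ t))) , mk⇔ (λ _ → quotientOdd-1) (λ _ → odd[1])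
φ-quotient-product t {q ∷ ps} (q-prime ∷ ps-prime) with φ-quotient-product t ps-prime
... | r , φ[td]≡rφ[t] , r-odd⇔ = f * r , φ[tqd]≡frφ[t] ,
  ⇔-trans odd-*⇔ (⇔-trans (⇔-refl ×-⇔ r-odd⇔) (⇔-sym (quotientOdd-*-prime q-prime)))
  where
  d = product ps
  f = φ-factor q (t * d)
  φ[tqd]≡frφ[t] : φ (t * (q * d)) ≡ f * r * φ t
  φ[tqd]≡frφ[t] = begin
    φ (t * (q * d))  ≡⟨ cong φ (trans (cong (t *_) (*-comm q d)) (sym (*-assoc t d q))) ⟩
    φ (t * d * q)    ≡⟨ φ-*-prime q-prime ⟩
    f * φ (t * d)    ≡⟨ cong (f *_) φ[td]≡rφ[t] ⟩
    f * (r * φ t)    ≡⟨ *-assoc f r (φ t) ⟨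
    f * r * φ t      ∎
    where open ≡-Reasoning

φ-quotient : ∀ t d .{{_ : NonZero d}} → ∃ λ r → φ (t * d) ≡ r * φ t × (Odd r ⇔ QuotientOdd d t)
φ-quotient t d with factorise d
... | record { factors = ps ; isFactorisation = d≡∏ps ; factorsPrime = ps-prime } =
  subst (λ d → ∃ λ r → φ (t * d) ≡ r * φ t × (Odd r ⇔ QuotientOdd d t)) (sym d≡∏ps) (φ-quotient-product t ps-prime)

SquareFree : ℕ → Set
SquareFree n = ∀ q → Prime q → ¬ q * q ∣ n

∣-1^k∣≡1 : ∀ k → ℤ.∣ (ℤ.- ℤ.1ℤ) ℤ.^ k ∣ ≡ 1
∣-1^k∣≡1 zero    = refl
∣-1^k∣≡1 (suc k) = trans (ℤP.abs-* (ℤ.- ℤ.1ℤ) ((ℤ.- ℤ.1ℤ) ℤ.^ k)) (trans (+-identityʳ _) (∣-1^k∣≡1 k))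

odd[μ*r]⇔ : ∀ t r .{{_ : NonZero t}} → Odd ℤ.∣ μ t ℤ.* + r ∣ ⇔ (SquareFree t × Odd r)
odd[μ*r]⇔ t r with all? (λ p → ¬? (prime? p ×-dec ((p * p) ∣? t))) (range1 t)
... | yes no-square = mk⇔
  (λ μr-odd → squareFree , subst Odd ∣μr∣≡r μr-odd)
  (λ (_ , r-odd) → subst Odd (sym ∣μr∣≡r) r-odd)
  where
  ∣μr∣≡r : ℤ.∣ (ℤ.- ℤ.1ℤ) ℤ.^ ω t ℤ.* + r ∣ ≡ r
  ∣μr∣≡r = trans (ℤP.abs-* ((ℤ.- ℤ.1ℤ) ℤ.^ ω t) (+ r)) (trans (cong (_* r) (∣-1^k∣≡1 (ω t))) (*-identityˡ r))
  squareFree : SquareFree t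
  squareFree q q-prime q²∣t = applyUpTo⁻ suc t no-square q∸1<t
    (subst Prime (sym 1+[q∸1]≡q) q-prime , subst (λ u → u * u ∣ t) (sym 1+[q∸1]≡q) q²∣t)
    where
    1+[q∸1]≡q : suc (q ∸ 1) ≡ q
    1+[q∸1]≡q = m+[n∸m]≡n (>-nonZero⁻¹ q {{prime⇒nonZero q-prime}})
    q∸1<t : q ∸ 1 < t
    q∸1<t = subst (_≤ t) (sym 1+[q∸1]≡q) (∣⇒≤ (∣-trans (m∣m*n q) q²∣t))
... | no square = mk⇔
  (λ 0-odd → ⊥-elim (0-odd (2 ∣0)))
  (λ (squareFree , _) → ⊥-elim (square (applyUpTo⁺₂ suc t (λ i (i-prime , i²∣t) → squareFree (suc i) i-prime i²∣t))))

q^[1+x]∣s*d⇒q^x∣d : ∀ {s d q} → SquareFree s → Prime q → ∀ x → q ^ suc x ∣ s * d → q ^ x ∣ d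
q^[1+x]∣s*d⇒q^x∣d {s} {d} {q} s-squareFree q-prime x q^[1+x]∣sd with q ∣? s
... | no  q∤s = ∣-trans (n∣m*n q) (prime^∣*⇒∣ q-prime q∤s (suc x) q^[1+x]∣sd)
... | yes (divides s′ refl) = prime^∣*⇒∣ q-prime q∤s′ x (*-cancelˡ-∣ q {{prime⇒nonZero q-prime}} q^[1+x]∣q*s′d)
  where
  q∤s′ : ¬ q ∣ s′
  q∤s′ q∣s′ = s-squareFree q q-prime (subst (q * q ∣_) (*-comm q s′) (*-monoʳ-∣ q q∣s′))
  q^[1+x]∣q*s′d : q * q ^ x ∣ q * (s′ * d)
  q^[1+x]∣q*s′d = subst (q * q ^ x ∣_) (trans (cong (_* d) (*-comm s′ q)) (*-assoc q s′ d)) q^[1+x]∣sd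

div-*-cancelʳ : ∀ m n .{{_ : NonZero n}} → (m * n) div n ≡ m
div-*-cancelʳ m (suc n) = m*n/n≡m m (suc n)

div*≡ : ∀ {m} n .{{_ : NonZero n}} → n ∣ m → m div n * n ≡ m
div*≡ (suc n) n∣m = m/n*n≡m n∣m

gcd≢0ˡ : ∀ m n .{{_ : NonZero m}} → NonZero (gcd m n)
gcd≢0ˡ m n = ≢-nonZero (gcd[m,n]≢0 m n (inj₁ (≢-nonZero⁻¹ m)))

t*gcd≡n : ∀ n j .{{_ : NonZero n}} → t n j * gcd n j ≡ n
t*gcd≡n n j = div*≡ (gcd n j) {{gcd≢0ˡ n j}} (gcd[m,n]∣m n j)

odd[c]⇔ : ∀ {n} j .{{_ : NonZero n}} → Odd ℤ.∣ c j n ∣ ⇔ (SquareFree (t n j) × QuotientOdd (gcd n j) (t n j))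
odd[c]⇔ {n} j with φ-quotient (t n j) (gcd n j) {{gcd≢0ˡ n j}}
... | r , φ[td]≡rφ[t] , r-odd⇔ =
  subst (λ z → Odd ℤ.∣ z ∣ ⇔ (SquareFree (t n j) × QuotientOdd (gcd n j) (t n j))) (sym c≡μ*r)
    (⇔-trans (odd[μ*r]⇔ (t n j) r) (⇔-refl ×-⇔ r-odd⇔))
  where
  instance
    t≢0 : NonZero (t n j)
    t≢0 = m*n≢0⇒m≢0 (t n j) {{subst NonZero (sym (t*gcd≡n n j)) it}}
  c≡μ*r : c j n ≡ μ (t n j) ℤ.* + r
  c≡μ*r = cong (λ z → μ (t n j) ℤ.* + z) (trans (cong (_div φ (t n j)) (trans (cong φ (sym (t*gcd≡n n j))) φ[td]≡rφ[t]))
            (div-*-cancelʳ r (φ (t n j)) {{>-nonZero (φ>0 (t n j))}}))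

-- Products of prime powers

prodFin-cong : ∀ {k} {f g : Fin k → ℕ} → (∀ i → f i ≡ g i) → prodFin k f ≡ prodFin k g
prodFin-cong {zero}  f≗g = refl
prodFin-cong {suc k} f≗g = cong₂ _*_ (f≗g Fin.zero) (prodFin-cong (f≗g ∘ Fin.suc))

∣prodFin : ∀ {k} (f : Fin k → ℕ) i → f i ∣ prodFin k f
∣prodFin f Fin.zero    = m∣m*n _
∣prodFin f (Fin.suc i) = ∣n⇒∣m*n (f Fin.zero) (∣prodFin (f ∘ Fin.suc) i)

prime∣prodFin⇒≡ : ∀ {k q} (p e : Fin k → ℕ) → (∀ i → Prime (p i)) → Prime q →
  q ∣ prodFin k (λ i → p i ^ e i) → ∃ λ i → q ≡ p i
prime∣prodFin⇒≡ {zero}      p e p-prime q-prime q∣1 = ⊥-elim (prime≢1 q-prime (∣1⇒≡1 q∣1))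
prime∣prodFin⇒≡ {suc k} {q} p e p-prime q-prime q∣∏ with euclidsLemma (p Fin.zero ^ e Fin.zero) _ q-prime q∣∏
... | inj₁ q∣p₀^e₀ = Fin.zero , prime∣^⇒≡ q-prime (p-prime Fin.zero) (e Fin.zero) q∣p₀^e₀
... | inj₂ q∣∏tail with prime∣prodFin⇒≡ (p ∘ Fin.suc) (e ∘ Fin.suc) (p-prime ∘ Fin.suc) q-prime q∣∏tail
...   | i , q≡pᵢ = Fin.suc i , q≡pᵢ

module _ {k} {p : Fin (suc k) → ℕ} (p-prime : ∀ i → Prime (p i)) (p-injective : Injective _≡_ _≡_ p) where

  head∤prodFin-tail : ∀ (e : Fin (suc k) → ℕ) → ¬ p Fin.zero ∣ prodFin k (λ i → p (Fin.suc i) ^ e (Fin.suc i))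
  head∤prodFin-tail e p₀∣∏tail with prime∣prodFin⇒≡ (p ∘ Fin.suc) (e ∘ Fin.suc) (p-prime ∘ Fin.suc) (p-prime Fin.zero) p₀∣∏tail
  ... | i , p₀≡pᵢ₊₁ = case p-injective p₀≡pᵢ₊₁ of λ ()

  tail-injective : Injective _≡_ _≡_ (p ∘ Fin.suc)
  tail-injective pᵢ₊₁≡pⱼ₊₁ = FinP.suc-injective (p-injective pᵢ₊₁≡pⱼ₊₁)

prodFin-split : ∀ {k} {p : Fin k → ℕ} → (∀ i → Prime (p i)) → Injective _≡_ _≡_ p → ∀ (e : Fin k → ℕ) i →
  ∃ λ m → prodFin k (λ i → p i ^ e i) ≡ p i ^ e i * m × ¬ p i ∣ m
prodFin-split {suc k} p-prime p-injective e Fin.zero = _ , refl , head∤prodFin-tail p-prime p-injective e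
prodFin-split {suc k} {p} p-prime p-injective e (Fin.suc i)
  with prodFin-split (p-prime ∘ Fin.suc) (tail-injective p-prime p-injective) (e ∘ Fin.suc) i
... | m , ∏tail≡pᵢ^eᵢ*m , pᵢ∤m = a * m , ∏≡ , pᵢ∤a*m
  where
  a = p Fin.zero ^ e Fin.zero
  b = p (Fin.suc i) ^ e (Fin.suc i)
  ∏≡ : a * prodFin k (λ i → p (Fin.suc i) ^ e (Fin.suc i)) ≡ b * (a * m)
  ∏≡ = trans (cong (a *_) ∏tail≡pᵢ^eᵢ*m) (x∙yz≈y∙xz a b m)
  pᵢ∤a*m : ¬ p (Fin.suc i) ∣ a * m
  pᵢ∤a*m pᵢ∣am with euclidsLemma a m (p-prime (Fin.suc i)) pᵢ∣am
  ... | inj₁ pᵢ∣a = case p-injective (sym (prime∣^⇒≡ (p-prime (Fin.suc i)) (p-prime Fin.zero) (e Fin.zero) pᵢ∣a)) of λ ()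
  ... | inj₂ pᵢ∣m = pᵢ∤m pᵢ∣m

prodFin-∣ : ∀ {k} {p : Fin k → ℕ} → (∀ i → Prime (p i)) → Injective _≡_ _≡_ p → ∀ (e : Fin k → ℕ) {x} →
  (∀ i → p i ^ e i ∣ x) → prodFin k (λ i → p i ^ e i) ∣ x
prodFin-∣ {zero}  _       _           e {x} _     = 1∣ x
prodFin-∣ {suc k} {p} p-prime p-injective e {x} pᵢ^eᵢ∣x
  with prodFin-∣ (p-prime ∘ Fin.suc) (tail-injective p-prime p-injective) (e ∘ Fin.suc) (pᵢ^eᵢ∣x ∘ Fin.suc)
... | divides w x≡w*∏tail = subst (a * ∏tail ∣_) (sym x≡w*∏tail) (*-monoˡ-∣ ∏tail a∣w)
  where
  a = p Fin.zero ^ e Fin.zero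
  ∏tail = prodFin k (λ i → p (Fin.suc i) ^ e (Fin.suc i))
  a∣w : a ∣ w
  a∣w = prime^∣*⇒∣ (p-prime Fin.zero) (head∤prodFin-tail p-prime p-injective e) (e Fin.zero)
          (subst (a ∣_) (trans x≡w*∏tail (*-comm w ∏tail)) (pᵢ^eᵢ∣x Fin.zero))

strictlyIncreasing⇒injective : ∀ {k} {p : Fin k → ℕ} → (∀ i j → i Fin.< j → p i < p j) → Injective _≡_ _≡_ p
strictlyIncreasing⇒injective {p = p} increasing {i} {j} pᵢ≡pⱼ with FinP.<-cmp i j
... | tri< i<j _ _ = ⊥-elim (<⇒≢ (increasing i j i<j) pᵢ≡pⱼ)
... | tri≈ _ i≡j _ = i≡j
... | tri> _ _ j<i = ⊥-elim (<⇒≢ (increasing j i j<i) (sym pᵢ≡pⱼ))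

ExactPower : ℕ → ℕ → ℕ → Set
ExactPower p e m = p ^ e ∣ m × ¬ p ^ suc e ∣ m

exactPowers⇔ : ∀ {k} {p : Fin k → ℕ} → (∀ i → Prime (p i)) → Injective _≡_ _≡_ p → ∀ (e : Fin k → ℕ) j →
  (∀ i → ExactPower (p i) (e i) j) ⇔ (∃ λ J → j ≡ prodFin k (λ i → p i ^ e i) * J × ∀ i → ¬ p i ∣ J)
exactPowers⇔ {k} {p} p-prime p-injective e j = mk⇔
  (λ exact → case prodFin-∣ p-prime p-injective e (proj₁ ∘ exact) of λ where
     (divides J j≡J*P) → J , trans j≡J*P (*-comm J P) ,
       λ i pᵢ∣J → proj₂ (exact i) (Equivalence.from (p^[1+e]∣j⇔ i J (trans j≡J*P (*-comm J P))) pᵢ∣J))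
  (λ (J , j≡P*J , pᵢ∤J) i →
     subst (p i ^ e i ∣_) (sym j≡P*J) (∣m⇒∣m*n J (∣prodFin (λ i → p i ^ e i) i)) ,
     λ p^[1+e]∣j → pᵢ∤J i (Equivalence.to (p^[1+e]∣j⇔ i J j≡P*J) p^[1+e]∣j))
  where
  P = prodFin k (λ i → p i ^ e i)
  p^[1+e]∣j⇔ : ∀ i J → j ≡ P * J → p i ^ suc (e i) ∣ j ⇔ p i ∣ J
  p^[1+e]∣j⇔ i J j≡P*J with prodFin-split p-prime p-injective e i
  ... | m , P≡pᵢ^eᵢ*m , pᵢ∤m = subst (λ x → p i ^ suc (e i) ∣ x ⇔ p i ∣ J) (sym j≡pᵢ^eᵢ*mJ)
    (⇔-trans (p^[1+e]∣p^e*m⇔p∣m (p i) {{prime⇒nonZero (p-prime i)}} (e i) (m * J))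
      (mk⇔ (λ pᵢ∣mJ → case euclidsLemma m J (p-prime i) pᵢ∣mJ of λ where
              (inj₁ pᵢ∣m) → ⊥-elim (pᵢ∤m pᵢ∣m)
              (inj₂ pᵢ∣J) → pᵢ∣J)
           (∣n⇒∣m*n m)))
    where
    j≡pᵢ^eᵢ*mJ : j ≡ p i ^ e i * (m * J)
    j≡pᵢ^eᵢ*mJ = trans j≡P*J (trans (cong (_* J) P≡pᵢ^eᵢ*m) (*-assoc (p i ^ e i) m J))

module Factorisation {k a n} {p e : Fin k → ℕ}
  (p-prime : ∀ i → Prime (p i)) (p-odd : ∀ i → Odd (p i)) (p-injective : Injective _≡_ _≡_ p)
  (n≡2^a*∏ : n ≡ 2 ^ a * prodFin k (λ i → p i ^ suc (e i))) where

  prime∣n⇒≡2⊎≡p : ∀ {q} → Prime q → q ∣ n → q ≡ 2 ⊎ ∃ λ i → q ≡ p i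
  prime∣n⇒≡2⊎≡p {q} q-prime q∣n with euclidsLemma (2 ^ a) _ q-prime (subst (q ∣_) n≡2^a*∏ q∣n)
  ... | inj₁ q∣2^a = inj₁ (prime∣^⇒≡ q-prime prime[2] a q∣2^a)
  ... | inj₂ q∣∏   = inj₂ (prime∣prodFin⇒≡ p (suc ∘ e) p-prime q-prime q∣∏)

  exactPower-n : ∀ i → ExactPower (p i) (suc (e i)) n
  exactPower-n i with prodFin-split p-prime p-injective (suc ∘ e) i
  ... | m , ∏≡pᵢ^αᵢ*m , pᵢ∤m = subst (ExactPower (p i) (suc (e i))) (sym n≡pᵢ^αᵢ*2^a*m)
    (m∣m*n _ , λ p^[2+e]∣ → pᵢ∤2^a*m (Equivalence.to (p^[1+e]∣p^e*m⇔p∣m (p i) {{prime⇒nonZero (p-prime i)}} (suc (e i)) _) p^[2+e]∣))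
    where
    n≡pᵢ^αᵢ*2^a*m : n ≡ p i ^ suc (e i) * (2 ^ a * m)
    n≡pᵢ^αᵢ*2^a*m = trans n≡2^a*∏ (trans (cong (2 ^ a *_) ∏≡pᵢ^αᵢ*m) (x∙yz≈y∙xz (2 ^ a) (p i ^ suc (e i)) m))
    pᵢ∤2^a*m : ¬ p i ∣ 2 ^ a * m
    pᵢ∤2^a*m pᵢ∣2^a*m = case euclidsLemma (2 ^ a) m (p-prime i) pᵢ∣2^a*m of λ where
      (inj₁ pᵢ∣2^a) → odd⇒≢2 (p-odd i) (prime∣^⇒≡ (p-prime i) prime[2] a pᵢ∣2^a)
      (inj₂ pᵢ∣m)   → pᵢ∤m pᵢ∣m

  p∤J⇔gcd[J,n]≡1⊎2 : ¬ 4 ∣ n → ∀ J → (∀ i → ¬ p i ∣ J) ⇔ (gcd J n ≡ 1 ⊎ gcd J n ≡ 2)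
  p∤J⇔gcd[J,n]≡1⊎2 4∤n J = mk⇔
    (λ pᵢ∤J → noOddPrime⇒≡1⊎≡2 (λ 4∣g → 4∤n (∣-trans 4∣g (gcd[m,n]∣n J n)))
      (λ q q-prime q-odd q∣g → case prime∣n⇒≡2⊎≡p q-prime (∣-trans q∣g (gcd[m,n]∣n J n)) of λ where
         (inj₁ q≡2)        → odd⇒≢2 q-odd q≡2
         (inj₂ (i , q≡pᵢ)) → pᵢ∤J i (subst (_∣ J) q≡pᵢ (∣-trans q∣g (gcd[m,n]∣m J n)))))
    (λ g≡1⊎≡2 i pᵢ∣J → case g≡1⊎≡2 of λ where
       (inj₁ g≡1) → prime≢1 (p-prime i) (∣1⇒≡1 (subst (p i ∣_) g≡1 (pᵢ∣g i pᵢ∣J)))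
       (inj₂ g≡2) → odd⇒≢2 (p-odd i) (prime∣2⇒≡2 (p-prime i) (subst (p i ∣_) g≡2 (pᵢ∣g i pᵢ∣J))))
    where
    pᵢ∣g : ∀ i → p i ∣ J → p i ∣ gcd J n
    pᵢ∣g i pᵢ∣J = gcd-greatest pᵢ∣J (∣-trans (m∣m*n (p i ^ e i)) (proj₁ (exactPower-n i)))

  module _ {j t d} (t*d≡n : t * d ≡ n) (d∣j : d ∣ j) (d-greatest : ∀ {x} → x ∣ n → x ∣ j → x ∣ d) where

    private
      ∣t*d⇒∣n : ∀ {x} → x ∣ t * d → x ∣ n
      ∣t*d⇒∣n = subst (_ ∣_) t*d≡n

      ∣n⇒∣t*d : ∀ {x} → x ∣ n → x ∣ t * d
      ∣n⇒∣t*d = subst (_ ∣_) (sym t*d≡n)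

    squareFree∧quotientOdd⇒ : SquareFree t → QuotientOdd d t → ¬ 4 ∣ n × (∀ i → ExactPower (p i) (e i) j)
    squareFree∧quotientOdd⇒ t-squareFree d-odd = 4∤n , λ i → pᵢ^eᵢ∣j i , pᵢ^αᵢ∤j i
      where
      open QuotientOdd d-odd
      4∤n : ¬ 4 ∣ n
      4∤n 4∣n with 2 ∣? d
      ... | yes 2∣d  = 4∤ (prime^∣*⇒∣ prime[2] (2∣⇒odd 2∣d) 2 (∣n⇒∣t*d 4∣n))
      ... | no d-odd = t-squareFree 2 prime[2] (prime^∣*⇒∣ prime[2] d-odd 2 (subst (4 ∣_) (*-comm t d) (∣n⇒∣t*d 4∣n)))
      pᵢ^eᵢ∣j : ∀ i → p i ^ e i ∣ j
      pᵢ^eᵢ∣j i = ∣-trans (q^[1+x]∣s*d⇒q^x∣d t-squareFree (p-prime i) (e i) (∣n⇒∣t*d (proj₁ (exactPower-n i)))) d∣j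
      pᵢ^αᵢ∤j : ∀ i → ¬ p i ^ suc (e i) ∣ j
      pᵢ^αᵢ∤j i pᵢ^αᵢ∣j = proj₂ (exactPower-n i) (∣t*d⇒∣n (*-pres-∣ pᵢ∣t pᵢ^αᵢ∣d))
        where
        pᵢ^αᵢ∣d : p i ^ suc (e i) ∣ d
        pᵢ^αᵢ∣d = d-greatest (proj₁ (exactPower-n i)) pᵢ^αᵢ∣j
        pᵢ∣t : p i ∣ t
        pᵢ∣t = odd-prime-∣ (p i) (p-prime i) (p-odd i) (∣-trans (m∣m*n (p i ^ e i)) pᵢ^αᵢ∣d)

    ⇒squareFree∧quotientOdd : ¬ 4 ∣ n → (∀ i → ExactPower (p i) (e i) j) → SquareFree t × QuotientOdd d t
    ⇒squareFree∧quotientOdd 4∤n exact = t-squareFree , record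
      { odd-prime-∣ = λ s s-prime s-odd s∣d → case prime∣n⇒≡2⊎≡p s-prime (∣-trans s∣d d∣n) of λ where
          (inj₁ s≡2)        → ⊥-elim (odd⇒≢2 s-odd s≡2)
          (inj₂ (i , refl)) → pᵢ∣t i
      ; 4∤          = λ 4∣d → 4∤n (∣-trans 4∣d d∣n)
      ; 2∣⇒odd      = λ 2∣d 2∣t → 4∤n (∣t*d⇒∣n (*-pres-∣ 2∣t 2∣d))
      }
      where
      d∣n : d ∣ n
      d∣n = ∣t*d⇒∣n (n∣m*n t)
      pᵢ^eᵢ∣d : ∀ i → p i ^ e i ∣ d
      pᵢ^eᵢ∣d i = d-greatest (∣-trans (n∣m*n (p i)) (proj₁ (exactPower-n i))) (proj₁ (exact i))
      t-squareFree : SquareFree t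
      t-squareFree q q-prime q²∣t with prime∣n⇒≡2⊎≡p q-prime (∣t*d⇒∣n (∣m⇒∣m*n d (∣-trans (m∣m*n q) q²∣t)))
      ... | inj₁ refl       = 4∤n (∣t*d⇒∣n (∣m⇒∣m*n d q²∣t))
      ... | inj₂ (i , refl) = proj₂ (exactPower-n i)
            (∣t*d⇒∣n (subst (_∣ t * d) (*-assoc (p i) (p i) (p i ^ e i)) (*-pres-∣ q²∣t (pᵢ^eᵢ∣d i))))
      pᵢ∣t : ∀ i → p i ∣ t
      pᵢ∣t i with p i ∣? t
      ... | yes pᵢ∣t = pᵢ∣t
      ... | no  pᵢ∤t = ⊥-elim (proj₂ (exact i)
            (∣-trans (prime^∣*⇒∣ (p-prime i) pᵢ∤t (suc (e i)) (∣n⇒∣t*d (proj₁ (exactPower-n i)))) d∣j))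

    squareFree∧quotientOdd⇔ : (SquareFree t × QuotientOdd d t) ⇔ (¬ 4 ∣ n × ∀ i → ExactPower (p i) (e i) j)
    squareFree∧quotientOdd⇔ = mk⇔ (uncurry squareFree∧quotientOdd⇒) (uncurry ⇒squareFree∧quotientOdd)

  p∤cofactor⇔gcd≡1⊎2 : ∀ j →
    (¬ 4 ∣ n × ∃ λ J → j ≡ prodFin k (λ i → p i ^ e i) * J × ∀ i → ¬ p i ∣ J) ⇔
    (¬ 4 ∣ n × ∃ λ J → j ≡ prodFin k (λ i → p i ^ e i) * J × (gcd J n ≡ 1 ⊎ gcd J n ≡ 2))
  p∤cofactor⇔gcd≡1⊎2 j = mk⇔
    (λ (4∤n , J , j≡P*J , pᵢ∤J)   → 4∤n , J , j≡P*J , Equivalence.to (p∤J⇔gcd[J,n]≡1⊎2 4∤n J) pᵢ∤J)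
    (λ (4∤n , J , j≡P*J , g≡1⊎2) → 4∤n , J , j≡P*J , Equivalence.from (p∤J⇔gcd[J,n]≡1⊎2 4∤n J) g≡1⊎2)

ℕ-cofactor⇔ℤ-cofactor : ∀ j P n →
  (∃ λ (J : ℕ) → j ≡ P * J × (gcd J n ≡ 1 ⊎ gcd J n ≡ 2)) ⇔
  (∃ λ (J : ℤ) → + j ≡ + P ℤ.* J × (ℤG.gcd J (+ n) ≡ + 1 ⊎ ℤG.gcd J (+ n) ≡ + 2))
ℕ-cofactor⇔ℤ-cofactor j P n = mk⇔
  (λ (J , j≡P*J , g≡1⊎2) → + J , trans (cong (λ m → + m) j≡P*J) (ℤP.pos-* P J) ,
                            Sum.map (cong (λ m → + m)) (cong (λ m → + m)) g≡1⊎2)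
  (λ (J , j≡P*J , g≡1⊎2) → ℤ.∣ J ∣ , trans (cong ℤ.∣_∣ j≡P*J) (ℤP.abs-* (+ P) J) ,
                            Sum.map (cong ℤ.∣_∣) (cong ℤ.∣_∣) g≡1⊎2)

mainTheorem7 : (n : ℕ) → 2 ≤ n →
    (k : ℕ) (p : Fin k → ℕ) (α : Fin k → ℕ) (α₀ : ℕ) →
    (∀ i → Prime (p i)) → (∀ i → ¬ (2 ∣ p i)) →
    (∀ i j → i Fin.< j → p i < p j) → (∀ i → 1 ≤ α i) →
    n ≡ 2 ^ α₀ * prodFin k (λ i → p i ^ α i) →
    (j : ℕ) →
    (¬ ((ℤ.+ 2) ℤD.∣ c j n))
      ⇔ (¬ (4 ∣ n) × ∃ λ (J : ℤ) →
            (+ j ≡ + prodFin k (λ i → p i ^ (α i ∸ 1)) ℤ.* J)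
              × (ℤG.gcd J (+ n) ≡ + 1 ⊎ ℤG.gcd J (+ n) ≡ + 2))
mainTheorem7 n@(suc _) _ k p α α₀ p-prime p-odd increasing α≥1 n≡2^α₀*∏ j =
  ⇔-trans (odd[c]⇔ j)
  (⇔-trans (squareFree∧quotientOdd⇔ (t*gcd≡n n j) (gcd[m,n]∣n n j) gcd-greatest)
  (⇔-trans (⇔-refl ×-⇔ exactPowers⇔ p-prime p-injective e j)
  (⇔-trans (p∤cofactor⇔gcd≡1⊎2 j)
           (⇔-refl ×-⇔ ℕ-cofactor⇔ℤ-cofactor j (prodFin k (λ i → p i ^ e i)) n))))
  where
  e : Fin k → ℕ
  e i = α i ∸ 1
  n≡2^α₀*∏p^[1+e] : n ≡ 2 ^ α₀ * prodFin k (λ i → p i ^ suc (e i))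
  n≡2^α₀*∏p^[1+e] = trans n≡2^α₀*∏ (cong (2 ^ α₀ *_) (prodFin-cong (λ i → cong (p i ^_) (sym (m+[n∸m]≡n (α≥1 i))))))
  p-injective : Injective _≡_ _≡_ p
  p-injective = strictlyIncreasing⇒injective increasing
  open Factorisation {a = α₀} {e = e} p-prime p-odd p-injective n≡2^α₀*∏p^[1+e]
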